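{- Let $r$ be an odd positive integer, $n=4r$, and $BL_r=2^{2r}+2^r+1$. Let $a\in\{1,\dots,2^n-2\}$ with binary expansion $a=\sum_{m=0}^{n-1}\alpha_m2^m$, and define the $r\times4$ matrix $(a_{i,j})_{0\le i\le r-1,\,0\le j\le3}$ by $a_{i,j}=\alpha_{(i-jr)\bmod n}$ (so $a\equiv\sum_{i,j}a_{i,j}2^{i-jr}\pmod{2^n-1}$). The following are equivalent: (a) $a$ is the inverse of $BL_r$ modulo $2^n-1$; (b) there exists an $r\times4$ matrix $(c_{i,j})$ with entries in $\{0,1,2\}$ such that $$2c_{0,0}-c_{r-1,1}+1=a_{0,2}+a_{0,1}+a_{0,0},$$ $$2c_{0,j}-c_{r-1,j+1}=a_{0,j+2}+a_{0,j+1}+a_{0,j}\quad\text{for } j\in\{1,2,3\},$$ $$2c_{i,j}-c_{i-1,j}=a_{i,j+2}+a_{i,j+1}+a_{i,j}\quad\text{for all } i\in\{1,\dots,r-1\},\ j\in\{0,1,2,3\},$$ where column indices are taken modulo $4$. Moreover, the matrix $(c_{i,j})$ in (b) is unique.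
   Context: Powers $2^{m}$ with arbitrary integer $m$ are understood modulo $2^n-1$, i.e. $2^m=2^{m\bmod n}$. -}

module Defs where

open import Data.Nat using (ℕ; zero; suc; _+_; _*_; _∸_; _^_; _<_; _≤_; NonZero)
open import Data.Nat.DivMod using (_%_; _/_)
open import Data.Nat.Properties using (m*n≢0)
open import Data.Nat.Divisibility using (_∣_)
open import Data.Integer as ℤ using (ℤ; +_)
open import Relation.Binary.PropositionalEquality using (_≡_)
open import Data.Product using (_×_)

bit : ℕ → ℕ → ℕ
bit a zero    = a % 2
bit a (suc m) = bit (a / 2) m

nOf : ℕ → ℕ
nOf r = 4 * r

-- a_{i,j} = α_{(i - j r) mod n}, for 0 ≤ i < r, 0 ≤ j < 4
-- (computed as (i + n - j r) mod n, which is the same since j r ≤ n)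
aEntry : (r : ℕ) .{{_ : NonZero r}} → ℕ → ℕ → ℕ → ℕ
aEntry r a i j = bit a (_%_ ((i + 4 * r) ∸ j * r) (4 * r) {{m*n≢0 4 r}})

BL : ℕ → ℕ
BL r = 2 ^ (2 * r) + 2 ^ r + 1

-- a is the inverse of BL_r modulo 2^n - 1 (for a ≥ 1, a*BL_r ≥ 1 so ∸ is exact)
IsInverseBL : ℕ → ℕ → Set
IsInverseBL r a = (2 ^ nOf r ∸ 1) ∣ (a * BL r ∸ 1)

-- an r × 4 matrix, indexed by (i , j) with i < r, j < 4 (values outside are irrelevant)
Matrix : Set
Matrix = ℕ → ℕ → ℕ

col : ℕ → ℕ
col j = j % 4

CondB : (r : ℕ) .{{_ : NonZero r}} → ℕ → Matrix → Set
CondB r a c =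
  (∀ i j → i < r → j < 4 → c i j ≤ 2)
  × (((+ (2 * c 0 0)) ℤ.- (+ c (r ∸ 1) 1)) ℤ.+ (+ 1)
       ≡ + (A 0 2 + A 0 1 + A 0 0))
  × (∀ j → 1 ≤ j → j ≤ 3 →
       (+ (2 * c 0 j)) ℤ.- (+ c (r ∸ 1) (col (j + 1)))
         ≡ + (A 0 (col (j + 2)) + A 0 (col (j + 1)) + A 0 j))
  × (∀ i j → 1 ≤ i → i < r → j < 4 →
       (+ (2 * c i j)) ℤ.- (+ c (i ∸ 1) j)
         ≡ + (A i (col (j + 2)) + A i (col (j + 1)) + A i j))
  where
  A : ℕ → ℕ → ℕ
  A = aEntry r a

module Submission where

-- Write a in base p = 2^r as v₀ + v₁p + v₂p² + v₃p³; column j of the matrix holds the bits of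
-- the block v₋ⱼ (indices mod 4). Modulo p⁴ − 1, multiplying by BLᵣ = p² + p + 1 adds to each
-- block its two cyclic predecessors, so a·BLᵣ ≡ Σ dₖ pᵏ where dₖ is the binary value of the
-- column sums aᵢ,ⱼ + aᵢ,ⱼ₊₁ + aᵢ,ⱼ₊₂ of column −k. Condition (b) says that c is the table of
-- carries of the bitwise addition of these column sums, going cyclically through all 4r
-- positions and producing the number 1 (the +1 at position (0,0)). Telescoping the carries up a
-- column yields carries in base p between the blocks, and telescoping those yields
-- Σ dₖ pᵏ = 1 + (p⁴ − 1)·K, hence (a). Conversely, from Σ dₖ pᵏ ≡ 1 the carries can be computed
-- top-down, first between the blocks and then inside each column; since every digit is at most
-- 3(B − 1) in the base B at hand, induction from the bottom shows that all carries lie in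
-- {0, 1, 2}. Two carry tables differ by D with D(cell) = 2·D(next cell) around the cycle,
-- so every entry of D is 4 times another one, which forces D = 0 as |D| ≤ 2.

open import Defs
open import Data.Integer as ℤ using (ℤ; +_; -[1+_]; ∣_∣)
import Data.Integer.Properties as ℤₚ
import Data.Integer.Tactic.RingSolver as ℤ-Ring
open import Data.Nat using (ℕ; zero; suc; _+_; _*_; _∸_; _^_; _<_; _≤_; _⊔_; z≤n; s≤s; z<s; NonZero)
open import Data.Nat.Properties
open import Data.Nat.DivMod using (_%_; _/_; m≡m%n+[m/n]*n; m%n<n; m<n⇒m%n≡m; [m+n]%n≡m%n; m<n*o⇒m/o<n)
open import Data.Nat.Divisibility using (_∣_; divides)
open import Data.Nat.Tactic.RingSolver using (solve-∀)
open import Data.Product using (_×_; ∃; ∃-syntax; _,_; proj₁; proj₂)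
open import Data.Sum using (inj₁; inj₂)
open import Data.Empty using (⊥-elim)
open import Function.Bundles using (_⇔_; mk⇔; Equivalence)
open import Relation.Binary.PropositionalEquality

shiftR : ℕ → ℕ → ℕ
shiftR a zero    = a
shiftR a (suc k) = shiftR (a / 2) k

bit-shiftR : ∀ k m a → bit a (k + m) ≡ bit (shiftR a k) m
bit-shiftR zero    m a = refl
bit-shiftR (suc k) m a = bit-shiftR k m (a / 2)

shiftR-+ : ∀ k m a → shiftR (shiftR a k) m ≡ shiftR a (k + m)
shiftR-+ zero    m a = refl
shiftR-+ (suc k) m a = shiftR-+ k m (a / 2)

shiftR-< : ∀ k {a y} → a < 2 ^ k * y → shiftR a k < y
shiftR-< zero    {a} {y} a<y = subst (a <_) (*-identityˡ y) a<y
shiftR-< (suc k) {a} {y} a<2^k*y =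
  shiftR-< k (m<n*o⇒m/o<n (subst (a <_) (reorder (2 ^ k) y) a<2^k*y))
  where
  reorder : ∀ x y → 2 * x * y ≡ x * y * 2
  reorder = solve-∀

bit≤1 : ∀ a m → bit a m ≤ 1
bit≤1 a zero    = ≤-pred (m%n<n a 2)
bit≤1 a (suc m) = bit≤1 (a / 2) m

eval : ℕ → (ℕ → ℕ) → ℕ → ℕ
eval B f zero    = 0
eval B f (suc m) = f 0 + B * eval B (λ i → f (suc i)) m

eval-cong : ∀ B m {f g} → (∀ i → i < m → f i ≡ g i) → eval B f m ≡ eval B g m
eval-cong B zero    f≗g = refl
eval-cong B (suc m) f≗g =
  cong₂ (λ x y → x + B * y) (f≗g 0 z<s) (eval-cong B m (λ i i<m → f≗g (suc i) (s≤s i<m)))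

eval-+ : ∀ B m f g → eval B (λ i → f i + g i) m ≡ eval B f m + eval B g m
eval-+ B zero    f g = refl
eval-+ B (suc m) f g = begin
  f 0 + g 0 + B * eval B (λ i → f (suc i) + g (suc i)) m
    ≡⟨ cong (λ x → f 0 + g 0 + B * x) (eval-+ B m (λ i → f (suc i)) (λ i → g (suc i))) ⟩
  f 0 + g 0 + B * (F + G)
    ≡⟨ regroup (f 0) (g 0) B F G ⟩
  f 0 + B * F + (g 0 + B * G) ∎
  where
  open ≡-Reasoning
  F = eval B (λ i → f (suc i)) m
  G = eval B (λ i → g (suc i)) m
  regroup : ∀ x y B u v → x + y + B * (u + v) ≡ x + B * u + (y + B * v)
  regroup = solve-∀

eval-≤ : ∀ B m {f b} → (∀ i → i < m → f i + b ≤ b * B) → eval B f m + b ≤ b * B ^ m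
eval-≤ B zero    {b = b} f≤ = ≤-reflexive (sym (*-identityʳ b))
eval-≤ B (suc m) {f} {b} f≤ = begin
  f 0 + B * E + b   ≡⟨ regroup (f 0) (B * E) b ⟩
  f 0 + b + B * E   ≤⟨ +-monoˡ-≤ (B * E) (f≤ 0 z<s) ⟩
  b * B + B * E     ≡⟨ regroup′ b B E ⟩
  B * (E + b)       ≤⟨ *-monoʳ-≤ B (eval-≤ B m (λ i i<m → f≤ (suc i) (s≤s i<m))) ⟩
  B * (b * B ^ m)   ≡⟨ regroup″ B b (B ^ m) ⟩
  b * (B * B ^ m)   ∎
  where
  open ≤-Reasoning
  E = eval B (λ i → f (suc i)) m
  regroup : ∀ x y b → x + y + b ≡ x + b + y
  regroup = solve-∀
  regroup′ : ∀ b B e → b * B + B * e ≡ B * (e + b)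
  regroup′ = solve-∀
  regroup″ : ∀ B b q → B * (b * q) ≡ b * (B * q)
  regroup″ = solve-∀

eval-bits : ∀ m a → a ≡ eval 2 (bit a) m + 2 ^ m * shiftR a m
eval-bits zero    a = sym (+-identityʳ a)
eval-bits (suc m) a = begin
  a                                ≡⟨ m≡m%n+[m/n]*n a 2 ⟩
  a % 2 + a / 2 * 2                ≡⟨ cong (λ x → a % 2 + x * 2) (eval-bits m (a / 2)) ⟩
  a % 2 + (E + 2 ^ m * S) * 2      ≡⟨ regroup (a % 2) E (2 ^ m) S ⟩
  a % 2 + 2 * E + 2 * 2 ^ m * S    ∎
  where
  open ≡-Reasoning
  E = eval 2 (bit (a / 2)) m
  S = shiftR (a / 2) m
  regroup : ∀ b e q s → b + (e + q * s) * 2 ≡ b + 2 * e + 2 * q * s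
  regroup = solve-∀

eval-blocks : ∀ r K a →
  a ≡ eval (2 ^ r) (λ k → eval 2 (bit (shiftR a (k * r))) r) K + (2 ^ r) ^ K * shiftR a (K * r)
eval-blocks r zero    a = sym (+-identityʳ a)
eval-blocks r (suc K) a = begin
  a                                        ≡⟨ eval-bits r a ⟩
  B₀ + p * shiftR a r                      ≡⟨ cong (λ x → B₀ + p * x) (eval-blocks r K (shiftR a r)) ⟩
  B₀ + p * (eval p (blocksOf (shiftR a r)) K + p ^ K * shiftR (shiftR a r) (K * r))
    ≡⟨ cong₂ (λ x y → B₀ + p * (x + p ^ K * y))
             (eval-cong p K (λ k _ → cong (λ x → eval 2 (bit x) r) (shiftR-+ r (k * r) a)))
             (shiftR-+ r (K * r) a) ⟩
  B₀ + p * (eval p (λ k → blocksOf a (suc k)) K + p ^ K * shiftR a (suc K * r))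
    ≡⟨ regroup B₀ p (eval p (λ k → blocksOf a (suc k)) K) (p ^ K) (shiftR a (suc K * r)) ⟩
  B₀ + p * eval p (λ k → blocksOf a (suc k)) K + p * p ^ K * shiftR a (suc K * r) ∎
  where
  open ≡-Reasoning
  p = 2 ^ r
  B₀ = eval 2 (bit a) r
  blocksOf : ℕ → ℕ → ℕ
  blocksOf x k = eval 2 (bit (shiftR x (k * r))) r
  regroup : ∀ b p e q s → b + p * (e + q * s) ≡ b + p * e + p * q * s
  regroup = solve-∀

via-difference : ∀ {i j a b : ℤ} → i ℤ.- j ≡ a ℤ.- b → a ≡ b → i ≡ j
via-difference {i} {j} {a} eq refl = ℤₚ.i-j≡0⇒i≡j i j (trans eq (ℤₚ.+-inverseʳ a))

via-differences : ∀ {i j a b c d : ℤ} →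
  i ℤ.- j ≡ (a ℤ.- b) ℤ.- (c ℤ.- d) → a ≡ b → c ≡ d → i ≡ j
via-differences {i} {j} {a} {c = c} eq refl refl =
  ℤₚ.i-j≡0⇒i≡j i j (trans eq (cong₂ ℤ._-_ (ℤₚ.+-inverseʳ a) (ℤₚ.+-inverseʳ c)))

affine⇔pos : ∀ a b c d e → a + b ≡ c * d + e ⇔ + a ℤ.+ + b ≡ + c ℤ.* + d ℤ.+ + e
affine⇔pos a b c d e = mk⇔
  (λ eq → trans (sym (ℤₚ.pos-+ a b)) (trans (cong +_ eq) pos-rhs))
  (λ eq → ℤₚ.+-injective (trans (ℤₚ.pos-+ a b) (trans eq (sym pos-rhs))))
  where
  pos-rhs : + (c * d + e) ≡ + c ℤ.* + d ℤ.+ + e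
  pos-rhs = trans (ℤₚ.pos-+ (c * d) e) (cong (ℤ._+ + e) (ℤₚ.pos-* c d))

pos-∸ : ∀ {m n} → n ≤ m → + (m ∸ n) ≡ + m ℤ.- + n
pos-∸ {m} {n} n≤m = trans (sym (ℤₚ.⊖-≥ n≤m)) (sym (ℤₚ.m-n≡m⊖n m n))

difference⇔ : ∀ x y e z → + (2 * x) ℤ.- + y ℤ.+ + e ≡ + z ⇔ z + y ≡ 2 * x + e
difference⇔ x y e z = mk⇔
  (λ eq → Equivalence.from (affine⇔pos z y 2 x e)
    (via-difference (flip (+ z) (+ y) (+ 2 ℤ.* + x) (+ e))
      (trans (sym eq) (cong (λ w → w ℤ.- + y ℤ.+ + e) (ℤₚ.pos-* 2 x)))))
  (λ eq → via-difference (unflip (+ z) (+ y) (+ (2 * x)) (+ e))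
    (sym (trans (Equivalence.to (affine⇔pos z y 2 x e) eq)
                (cong (ℤ._+ + e) (sym (ℤₚ.pos-* 2 x))))))
  where
  flip : ∀ z y x e → z ℤ.+ y ℤ.- (x ℤ.+ e) ≡ z ℤ.- (x ℤ.- y ℤ.+ e)
  flip = ℤ-Ring.solve-∀
  unflip : ∀ z y x e → x ℤ.- y ℤ.+ e ℤ.- z ≡ x ℤ.+ e ℤ.- (z ℤ.+ y)
  unflip = ℤ-Ring.solve-∀

difference⇔′ : ∀ x y z → + (2 * x) ℤ.- + y ≡ + z ⇔ z + y ≡ 2 * x
difference⇔′ x y z = mk⇔
  (λ eq → trans (Equivalence.to (difference⇔ x y 0 z) (trans (ℤₚ.+-identityʳ _) eq)) (+-identityʳ _))
  (λ eq → trans (sym (ℤₚ.+-identityʳ _))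
             (Equivalence.from (difference⇔ x y 0 z) (trans eq (sym (+-identityʳ _)))))

-- Adding the digits s₀ … sₘ in base B to an incoming carry y at position 0 gives the digit e
-- there, the digit 0 everywhere else, and the carries c₀ … cₘ.
record CarryChain (B : ℕ) (s c : ℕ → ℕ) (m y e : ℕ) : Set where
  field
    base : s 0 + y ≡ B * c 0 + e
    step : ∀ i → i < m → s (suc i) + c i ≡ B * c (suc i)

eval-carriesℤ : ∀ B m {s : ℕ → ℕ} {X : ℕ → ℤ} {y e : ℤ} →
  + s 0 ℤ.+ y ≡ + B ℤ.* X 0 ℤ.+ e →
  (∀ i → i < m → + s (suc i) ℤ.+ X i ≡ + B ℤ.* X (suc i)) →
  + eval B s (suc m) ℤ.+ y ≡ + (B ^ suc m) ℤ.* X m ℤ.+ e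
eval-carriesℤ B zero {s} {X} {y} {e} base _ =
  trans (cong (λ n → + n ℤ.+ y) (trans (cong (λ x → s 0 + x) (*-zeroʳ B)) (+-identityʳ (s 0))))
        (trans base (cong (λ b → + b ℤ.* X 0 ℤ.+ e) (sym (*-identityʳ B))))
eval-carriesℤ B (suc m) {s} {X} {y} {e} base step = begin
  + (s 0 + B * E) ℤ.+ y
    ≡⟨ cong (ℤ._+ y) (trans (ℤₚ.pos-+ (s 0) (B * E)) (cong (λ z → + s 0 ℤ.+ z) (ℤₚ.pos-* B E))) ⟩
  + s 0 ℤ.+ + B ℤ.* + E ℤ.+ y               ≡⟨ lift (+ s 0) (+ B) (+ E) y ⟩
  (+ s 0 ℤ.+ y) ℤ.+ + B ℤ.* + E             ≡⟨ cong (ℤ._+ + B ℤ.* + E) base ⟩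
  + B ℤ.* X 0 ℤ.+ e ℤ.+ + B ℤ.* + E         ≡⟨ shift (+ B) (X 0) e (+ E) ⟩
  + B ℤ.* (+ E ℤ.+ X 0) ℤ.+ e               ≡⟨ cong (λ z → + B ℤ.* z ℤ.+ e) upper ⟩
  + B ℤ.* (+ Bᵐ ℤ.* X (suc m) ℤ.+ + 0) ℤ.+ e ≡⟨ cong (ℤ._+ e) (distrib (+ B) (+ Bᵐ) (X (suc m))) ⟩
  + B ℤ.* + Bᵐ ℤ.* X (suc m) ℤ.+ e          ≡⟨ cong (λ z → z ℤ.* X (suc m) ℤ.+ e) (ℤₚ.pos-* B Bᵐ) ⟨
  + (B * Bᵐ) ℤ.* X (suc m) ℤ.+ e            ∎
  where
  open ≡-Reasoning
  E = eval B (λ i → s (suc i)) (suc m)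
  Bᵐ = B ^ suc m
  upper : + E ℤ.+ X 0 ≡ + Bᵐ ℤ.* X (suc m) ℤ.+ + 0
  upper = eval-carriesℤ B m {λ i → s (suc i)} {λ i → X (suc i)} {X 0}
    (trans (step 0 z<s) (sym (ℤₚ.+-identityʳ _))) (λ i i<m → step (suc i) (s≤s i<m))
  lift : ∀ a b x c → a ℤ.+ b ℤ.* x ℤ.+ c ≡ (a ℤ.+ c) ℤ.+ b ℤ.* x
  lift = ℤ-Ring.solve-∀
  shift : ∀ b a c x → b ℤ.* a ℤ.+ c ℤ.+ b ℤ.* x ≡ b ℤ.* (x ℤ.+ a) ℤ.+ c
  shift = ℤ-Ring.solve-∀
  distrib : ∀ b a x → b ℤ.* (a ℤ.* x ℤ.+ + 0) ≡ b ℤ.* a ℤ.* x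
  distrib = ℤ-Ring.solve-∀

eval-carries : ∀ B m {s c y e} → CarryChain B s c m y e → eval B s (suc m) + y ≡ B ^ suc m * c m + e
eval-carries B m {s} {c} {y} {e} chain =
  Equivalence.from (affine⇔pos (eval B s (suc m)) y (B ^ suc m) (c m) e)
    (eval-carriesℤ B m {s} {λ i → + c i} {+ y} (Equivalence.to (affine⇔pos (s 0) y B (c 0) e) base) stepℤ)
  where
  open CarryChain chain
  stepℤ : ∀ i → i < m → + s (suc i) ℤ.+ + c i ≡ + B ℤ.* + c (suc i)
  stepℤ i i<m = trans (Equivalence.to (affine⇔pos (s (suc i)) (c i) B (c (suc i)) 0)
                                      (trans (step i i<m) (sym (+-identityʳ _))))
                      (ℤₚ.+-identityʳ _)

IsCarry : ℤ → Set
IsCarry x = ∃[ n ] x ≡ + n × n ≤ 2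

carry-bound : ∀ {B u} x → 2 ≤ B → + B ℤ.* x ℤ.+ + 1 ≡ + u → u ≤ 3 * B → IsCarry x
carry-bound {B} {u} (+ n) 2≤B eq u≤3B = n , refl , ≤-pred (*-cancelˡ-< B n 3 Bn<B*3)
  where
  Bn+1≡u : B * n + 1 ≡ u
  Bn+1≡u = ℤₚ.+-injective (trans (ℤₚ.pos-+ (B * n) 1) (trans (cong (ℤ._+ + 1) (ℤₚ.pos-* B n)) eq))
  Bn<B*3 : B * n < B * 3
  Bn<B*3 = begin-strict
    B * n      <⟨ n<1+n (B * n) ⟩
    suc (B * n) ≡⟨ trans (+-comm 1 (B * n)) Bn+1≡u ⟩
    u          ≤⟨ u≤3B ⟩
    3 * B      ≡⟨ *-comm 3 B ⟩
    B * 3      ∎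
    where open ≤-Reasoning
carry-bound {B} {u} -[1+ n ] 2≤B eq _ = ⊥-elim (<⇒≱ 2≤B B≤1)
  where
  cancel : ∀ b x → b ℤ.* ℤ.- x ℤ.+ + 1 ℤ.+ b ℤ.* x ≡ + 1
  cancel = ℤ-Ring.solve-∀
  u+Bn≡1 : + (u + B * suc n) ≡ + 1
  u+Bn≡1 = begin
    + (u + B * suc n)
      ≡⟨ trans (ℤₚ.pos-+ u (B * suc n)) (cong (λ z → + u ℤ.+ z) (ℤₚ.pos-* B (suc n))) ⟩
    + u ℤ.+ + B ℤ.* + suc n                      ≡⟨ cong (ℤ._+ + B ℤ.* + suc n) (sym eq) ⟩
    + B ℤ.* -[1+ n ] ℤ.+ + 1 ℤ.+ + B ℤ.* + suc n ≡⟨ cancel (+ B) (+ suc n) ⟩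
    + 1                                          ∎
    where open ≡-Reasoning
  B≤1 : B ≤ 1
  B≤1 = begin
    B               ≤⟨ m≤m*n B (suc n) ⟩
    B * suc n       ≤⟨ m≤n+m (B * suc n) u ⟩
    u + B * suc n   ≡⟨ ℤₚ.+-injective u+Bn≡1 ⟩
    1               ∎
    where open ≤-Reasoning

carry-step : ∀ {B t y e} x → 2 ≤ B → t + 3 ≤ 3 * B → y ≤ 2 → e ≤ 1 →
  + t ℤ.+ + y ≡ + B ℤ.* x ℤ.+ + e → IsCarry x
carry-step {B} {t} {y} x 2≤B t+3≤3B y≤2 z≤n eq = carry-bound x 2≤B Bx+1≡ t+y+1≤3B
  where
  Bx+1≡ : + B ℤ.* x ℤ.+ + 1 ≡ + (t + y + 1)
  Bx+1≡ = begin
    + B ℤ.* x ℤ.+ + 1            ≡⟨ cong (ℤ._+ + 1) (ℤₚ.+-identityʳ (+ B ℤ.* x)) ⟨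
    + B ℤ.* x ℤ.+ + 0 ℤ.+ + 1    ≡⟨ cong (ℤ._+ + 1) eq ⟨
    + t ℤ.+ + y ℤ.+ + 1          ≡⟨ cong (ℤ._+ + 1) (ℤₚ.pos-+ t y) ⟨
    + (t + y) ℤ.+ + 1            ≡⟨ ℤₚ.pos-+ (t + y) 1 ⟨
    + (t + y + 1)                ∎
    where open ≡-Reasoning
  t+y+1≤3B : t + y + 1 ≤ 3 * B
  t+y+1≤3B = begin
    t + y + 1   ≡⟨ +-assoc t y 1 ⟩
    t + (y + 1) ≤⟨ +-monoʳ-≤ t (+-monoˡ-≤ 1 y≤2) ⟩
    t + 3       ≤⟨ t+3≤3B ⟩
    3 * B       ∎
    where open ≤-Reasoning
carry-step {B} {t} {y} x 2≤B t+3≤3B y≤2 (s≤s z≤n) eq =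
  carry-bound x 2≤B (trans (sym eq) (sym (ℤₚ.pos-+ t y)))
    (≤-trans (+-monoʳ-≤ t (≤-trans y≤2 (n≤1+n 2))) t+3≤3B)

carry-nat : ∀ {x} → IsCarry x → + ∣ x ∣ ≡ x
carry-nat (n , refl , _) = refl

carry-≤2 : ∀ {x} → IsCarry x → ∣ x ∣ ≤ 2
carry-≤2 (n , refl , n≤2) = n≤2

-- The carries are computed downwards from the top carry k; that they lie in {0, 1, 2} is then
-- proved upwards from the bottom, from the bound on the digits.
module CarriesFromTop (B : ℕ) (s : ℕ → ℕ) (m k : ℕ) where

  fromTop : ℕ → ℤ
  fromTop zero    = + k
  fromTop (suc d) = + B ℤ.* fromTop d ℤ.- + s (m ∸ d)

  carryℤ : ℕ → ℤ
  carryℤ i = fromTop (m ∸ i)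

  carry : ℕ → ℕ
  carry i = ∣ carryℤ i ∣

  carryℤ-top : carryℤ m ≡ + k
  carryℤ-top = cong fromTop (n∸n≡0 m)

  carry-top : carry m ≡ k
  carry-top = cong ∣_∣ carryℤ-top

  private
    cancel : ∀ a b x → a ℤ.+ (b ℤ.* x ℤ.- a) ≡ b ℤ.* x
    cancel = ℤ-Ring.solve-∀

  carryℤ-step : ∀ i → i < m → + s (suc i) ℤ.+ carryℤ i ≡ + B ℤ.* carryℤ (suc i)
  carryℤ-step i i<m = begin
    + s (suc i) ℤ.+ fromTop (m ∸ i)
      ≡⟨ cong (λ d → + s (suc i) ℤ.+ fromTop d) (+-∸-assoc 1 i<m) ⟩
    + s (suc i) ℤ.+ (+ B ℤ.* X ℤ.- + s (m ∸ (m ∸ suc i)))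
      ≡⟨ cong (λ j → + s (suc i) ℤ.+ (+ B ℤ.* X ℤ.- + s j)) (m∸[m∸n]≡n i<m) ⟩
    + s (suc i) ℤ.+ (+ B ℤ.* X ℤ.- + s (suc i))
      ≡⟨ cancel (+ s (suc i)) (+ B) X ⟩
    + B ℤ.* X
      ∎
    where
    open ≡-Reasoning
    X = carryℤ (suc i)

  carries-chain : ∀ {y e} → 2 ≤ B → (∀ i → i ≤ m → s i + 3 ≤ 3 * B) → k ≤ 2 → y ≤ 2 → e ≤ 1 →
    eval B s (suc m) + y ≡ B ^ suc m * k + e →
    CarryChain B s carry m y e × (∀ i → i ≤ m → carry i ≤ 2)
  carries-chain {y} {e} 2≤B s≤ k≤2 y≤2 e≤1 total = chain , (λ i i≤m → carry-≤2 (isCarry i i≤m))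
    where
    X₀ = carryℤ 0
    baseℤ : + s 0 ℤ.+ + y ≡ + B ℤ.* X₀ ℤ.+ + e
    baseℤ = via-differences (compare (+ s 0) (+ y) (+ B) X₀ (+ e) (+ eval B s (suc m)) (+ (B ^ suc m) ℤ.* + k))
      (Equivalence.to (affine⇔pos (eval B s (suc m)) y (B ^ suc m) k e) total)
      (trans (eval-carriesℤ B m {s} {carryℤ} {+ B ℤ.* X₀ ℤ.- + s 0}
               (trans (cancel (+ s 0) (+ B) X₀) (sym (ℤₚ.+-identityʳ _))) carryℤ-step)
             (cong (λ x → + (B ^ suc m) ℤ.* x ℤ.+ + 0) carryℤ-top))
      where
      compare : ∀ s₀ y b x₀ e E K → s₀ ℤ.+ y ℤ.- (b ℤ.* x₀ ℤ.+ e)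
        ≡ (E ℤ.+ y ℤ.- (K ℤ.+ e)) ℤ.- (E ℤ.+ (b ℤ.* x₀ ℤ.- s₀) ℤ.- (K ℤ.+ + 0))
      compare = ℤ-Ring.solve-∀
    isCarry : ∀ i → i ≤ m → IsCarry (carryℤ i)
    isCarry zero    _   = carry-step X₀ 2≤B (s≤ 0 z≤n) y≤2 e≤1 baseℤ
    isCarry (suc i) i<m with isCarry i (≤-trans (n≤1+n i) i<m)
    ... | n , eq , n≤2 = carry-step (carryℤ (suc i)) 2≤B (s≤ (suc i) i<m) n≤2 z≤n
      (trans (cong (λ x → + s (suc i) ℤ.+ x) (sym eq))
             (trans (carryℤ-step i i<m) (sym (ℤₚ.+-identityʳ _))))
    chain : CarryChain B s carry m y e
    chain = record
      { base = Equivalence.from (affine⇔pos (s 0) y B (carry 0) e)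
          (trans baseℤ (cong (λ x → + B ℤ.* x ℤ.+ + e) (sym (carry-nat (isCarry 0 z≤n)))))
      ; step = λ i i<m → trans
          (Equivalence.from (affine⇔pos (s (suc i)) (carry i) B (carry (suc i)) 0)
            (begin
              + s (suc i) ℤ.+ + carry i   ≡⟨ cong (λ x → + s (suc i) ℤ.+ x) (carry-nat (isCarry i (<⇒≤ i<m))) ⟩
              + s (suc i) ℤ.+ carryℤ i    ≡⟨ carryℤ-step i i<m ⟩
              + B ℤ.* carryℤ (suc i)      ≡⟨ cong (λ x → + B ℤ.* x) (carry-nat (isCarry (suc i) i<m)) ⟨
              + B ℤ.* + carry (suc i)     ≡⟨ ℤₚ.+-identityʳ _ ⟨
              + B ℤ.* + carry (suc i) ℤ.+ + 0 ∎))
          (+-identityʳ _)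
      }
      where open ≡-Reasoning

carry-difference : ∀ B {z y y′ x x′ e} → z + y ≡ B * x + e → z + y′ ≡ B * x′ + e →
  + y ℤ.- + y′ ≡ + B ℤ.* (+ x ℤ.- + x′)
carry-difference B {z} {y} {y′} {x} {x′} {e} eq eq′ = via-differences
  (compare (+ B) (+ z) (+ y) (+ y′) (+ x) (+ x′) (+ e))
  (Equivalence.to (affine⇔pos z y B x e) eq)
  (Equivalence.to (affine⇔pos z y′ B x′ e) eq′)
  where
  compare : ∀ b z y y′ x x′ e → y ℤ.- y′ ℤ.- b ℤ.* (x ℤ.- x′)
    ≡ (z ℤ.+ y ℤ.- (b ℤ.* x ℤ.+ e)) ℤ.- (z ℤ.+ y′ ℤ.- (b ℤ.* x′ ℤ.+ e))
  compare = ℤ-Ring.solve-∀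

m-n≡4z⇒m≡n : ∀ {m n} z → m ≤ 2 → n ≤ 2 → + m ℤ.- + n ≡ + 4 ℤ.* z → m ≡ n
m-n≡4z⇒m≡n {m} {n} z m≤2 n≤2 eq = ℤₚ.+-injective (ℤₚ.i-j≡0⇒i≡j (+ m) (+ n) m-n≡0)
  where
  4∣z∣≤2 : 4 * ∣ z ∣ ≤ 2
  4∣z∣≤2 = begin
    4 * ∣ z ∣            ≡⟨ ℤₚ.abs-* (+ 4) z ⟨
    ∣ + 4 ℤ.* z ∣        ≡⟨ cong ∣_∣ (trans (sym eq) (ℤₚ.m-n≡m⊖n m n)) ⟩
    ∣ m ℤ.⊖ n ∣          ≤⟨ ℤₚ.∣m⊝n∣≤m⊔n m n ⟩
    m ⊔ n                ≤⟨ ⊔-lub m≤2 n≤2 ⟩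
    2                    ∎
    where open ≤-Reasoning
  z≡0 : z ≡ + 0
  z≡0 = ℤₚ.∣i∣≡0⇒i≡0 (n<1⇒n≡0 (*-cancelˡ-< 4 ∣ z ∣ 1 (≤-trans (s≤s 4∣z∣≤2) (n≤1+n 3))))
  m-n≡0 : + m ℤ.- + n ≡ + 0
  m-n≡0 = trans eq (trans (cong (+ 4 ℤ.*_) z≡0) (ℤₚ.*-zeroʳ (+ 4)))

pred∣pred⇔ : ∀ {x P} → 1 ≤ x → 1 ≤ P → (P ∸ 1) ∣ (x ∸ 1) ⇔ (∃[ q ] x + q ≡ P * q + 1)
pred∣pred⇔ {suc x} {suc P} _ _ = mk⇔
  (λ { (divides q refl) → q , sym (shuffle q P) })
  (λ (q , eq) → divides q (+-cancelʳ-≡ q x (q * P) (suc-injective (trans eq (shuffle q P)))))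
  where
  shuffle : ∀ q P → (1 + P) * q + 1 ≡ 1 + (q * P + q)
  shuffle = solve-∀

rotation : ∀ p v → eval p v 4 * (p * p + p + 1) + (v 2 + v 3 + p * v 3)
  ≡ p ^ 4 * (v 2 + v 3 + p * v 3) + eval p (λ i → v ((i + 2) % 4) + v ((i + 3) % 4) + v i) 4
rotation p v = identity p (v 0) (v 1) (v 2) (v 3)
  where
  identity : ∀ p v₀ v₁ v₂ v₃ →
    (v₀ + p * (v₁ + p * (v₂ + p * (v₃ + p * 0)))) * (p * p + p + 1) + (v₂ + v₃ + p * v₃)
    ≡ p * (p * (p * (p * 1))) * (v₂ + v₃ + p * v₃)
      + ((v₂ + v₃ + v₀) + p * ((v₃ + v₀ + v₁) + p * ((v₀ + v₁ + v₂) + p * ((v₁ + v₂ + v₃) + p * 0))))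
  identity = solve-∀

-- The bits of the product 1: a single one, at the bottom of column 0.
δ : ℕ → ℕ
δ zero    = 1
δ (suc _) = 0

δ≤1 : ∀ j → δ j ≤ 1
δ≤1 zero    = ≤-refl
δ≤1 (suc _) = z≤n

-- Column j of the matrix holds the bits of the r-bit block of a with index (−j) mod 4.
opposite : ℕ → ℕ
opposite j = (4 ∸ j) % 4

opposite-involutive : ∀ {j} → j < 4 → opposite (opposite j) ≡ j
opposite-involutive {0} _ = refl
opposite-involutive {1} _ = refl
opposite-involutive {2} _ = refl
opposite-involutive {3} _ = refl
opposite-involutive {suc (suc (suc (suc _)))} (s≤s (s≤s (s≤s (s≤s ()))))

module BLInverse (r′ a : ℕ) where

  r p : ℕ
  r = suc r′
  p = 2 ^ r

  A : ℕ → ℕ → ℕ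
  A = aEntry r a

  s : ℕ → ℕ → ℕ
  s j i = A i (col (j + 2)) + A i (col (j + 1)) + A i j

  V T d : ℕ → ℕ
  V j = eval 2 (λ i → A i j) r
  T j = eval 2 (s j) r
  d i = T (opposite i)

  -- The part of a · (p² + p + 1) beyond p⁴, which wraps around modulo p⁴ − 1.
  Q : ℕ
  Q = V 2 + V 1 + p * V 1

  2≤p : 2 ≤ p
  2≤p = *-monoʳ-≤ 2 (m^n>0 2 r′)

  2^4r≡p^4 : 2 ^ (4 * r) ≡ p ^ 4
  2^4r≡p^4 = trans (cong (2 ^_) (*-comm 4 r)) (sym (^-*-assoc 2 r 4))

  BL≡ : BL r ≡ p * p + p + 1
  BL≡ = cong (λ x → x + p + 1)
    (trans (^-distribˡ-+-* 2 r (r + 0)) (cong (λ n → p * 2 ^ n) (+-identityʳ r)))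

  offset<4r : ∀ {k i} → k < 4 → i < r → k * r + i < 4 * r
  offset<4r {k} {i} k<4 i<r = begin-strict
    k * r + i   <⟨ +-monoʳ-< (k * r) i<r ⟩
    k * r + r   ≡⟨ +-comm (k * r) r ⟩
    suc k * r   ≤⟨ *-monoˡ-≤ r k<4 ⟩
    4 * r       ∎
    where open ≤-Reasoning

  position : ∀ {i j} → i < r → j < 4 → (i + 4 * r ∸ j * r) % (4 * r) ≡ opposite j * r + i
  position {i} {zero} i<r _ =
    trans ([m+n]%n≡m%n i (4 * r)) (m<n⇒m%n≡m (<-≤-trans i<r (m≤n*m r 4)))
  position {i} {suc j} i<r j<4 = begin
    (i + 4 * r ∸ suc j * r) % (4 * r)
      ≡⟨ cong (λ n → (i + n * r ∸ suc j * r) % (4 * r)) (m∸n+n≡m sj≤4) ⟨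
    (i + (k + suc j) * r ∸ suc j * r) % (4 * r)
      ≡⟨ cong (λ n → (n ∸ suc j * r) % (4 * r)) (regroup i k (suc j) r) ⟩
    (k * r + i + suc j * r ∸ suc j * r) % (4 * r) ≡⟨ cong (_% (4 * r)) (m+n∸n≡m (k * r + i) (suc j * r)) ⟩
    (k * r + i) % (4 * r)                    ≡⟨ m<n⇒m%n≡m kr+i<4r ⟩
    k * r + i                                ≡⟨ cong (λ n → n * r + i) (m<n⇒m%n≡m k<4) ⟨
    opposite (suc j) * r + i                 ∎
    where
    open ≡-Reasoning
    k = 4 ∸ suc j
    sj≤4 : suc j ≤ 4
    sj≤4 = <⇒≤ j<4
    k<4 : k < 4
    k<4 = s≤s (m∸n≤m 3 j)
    regroup : ∀ i k j r → i + (k + j) * r ≡ k * r + i + j * r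
    regroup = solve-∀
    kr+i<4r : k * r + i < 4 * r
    kr+i<4r = offset<4r k<4 i<r

  entry-bit : ∀ {i j} → i < r → j < 4 → A i j ≡ bit (shiftR a (opposite j * r)) i
  entry-bit {i} {j} i<r j<4 = trans (cong (bit a) (position i<r j<4)) (bit-shiftR (opposite j * r) i a)

  a≡blocks : a < 2 ^ (4 * r) → a ≡ eval p (λ k → V (opposite k)) 4
  a≡blocks a<2^4r = begin
    a                                        ≡⟨ eval-blocks r 4 a ⟩
    eval p block 4 + p ^ 4 * shiftR a (4 * r) ≡⟨ cong (λ x → eval p block 4 + p ^ 4 * x) top≡0 ⟩
    eval p block 4 + p ^ 4 * 0
      ≡⟨ trans (cong (λ x → eval p block 4 + x) (*-zeroʳ (p ^ 4))) (+-identityʳ _) ⟩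
    eval p block 4                            ≡⟨ eval-cong p 4 (λ k k<4 → sym (V-block k k<4)) ⟩
    eval p (λ k → V (opposite k)) 4          ∎
    where
    open ≡-Reasoning
    block : ℕ → ℕ
    block k = eval 2 (bit (shiftR a (k * r))) r
    top≡0 : shiftR a (4 * r) ≡ 0
    top≡0 = n<1⇒n≡0 (shiftR-< (4 * r) (subst (a <_) (sym (*-identityʳ _)) a<2^4r))
    V-block : ∀ k → k < 4 → V (opposite k) ≡ block k
    V-block k k<4 = begin
      V (opposite k)
        ≡⟨ eval-cong 2 r (λ i i<r → entry-bit i<r (m%n<n (4 ∸ k) 4)) ⟩
      eval 2 (bit (shiftR a (opposite (opposite k) * r))) r
        ≡⟨ cong (λ n → eval 2 (bit (shiftR a (n * r))) r) (opposite-involutive k<4) ⟩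
      block k                                                ∎

  T-columns : ∀ j → T j ≡ V (col (j + 2)) + V (col (j + 1)) + V j
  T-columns j = trans
    (eval-+ 2 r (λ i → A i (col (j + 2)) + A i (col (j + 1))) (λ i → A i j))
    (cong (_+ V j) (eval-+ 2 r (λ i → A i (col (j + 2))) (λ i → A i (col (j + 1)))))

  a*BL-rotation : a < 2 ^ (4 * r) → a * BL r + Q ≡ p ^ 4 * Q + eval p d 4
  a*BL-rotation a<2^4r = begin
    a * BL r + Q                             ≡⟨ cong₂ (λ x y → x * y + Q) (a≡blocks a<2^4r) BL≡ ⟩
    eval p v 4 * (p * p + p + 1) + Q         ≡⟨ rotation p v ⟩
    p ^ 4 * Q + eval p (λ i → v ((i + 2) % 4) + v ((i + 3) % 4) + v i) 4
                                             ≡⟨ cong (λ x → p ^ 4 * Q + x) (eval-cong p 4 digit) ⟩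
    p ^ 4 * Q + eval p d 4                   ∎
    where
    open ≡-Reasoning
    v : ℕ → ℕ
    v k = V (opposite k)
    digit : ∀ i → i < 4 → v ((i + 2) % 4) + v ((i + 3) % 4) + v i ≡ d i
    digit 0 _ = sym (T-columns 0)
    digit 1 _ = sym (T-columns 3)
    digit 2 _ = sym (T-columns 2)
    digit 3 _ = sym (T-columns 1)
    digit (suc (suc (suc (suc _)))) (s≤s (s≤s (s≤s (s≤s ()))))

  A≤1 : ∀ i j → A i j ≤ 1
  A≤1 i j = bit≤1 a ((i + 4 * r ∸ j * r) % (4 * r))

  s≤ : ∀ j i → s j i + 3 ≤ 3 * 2
  s≤ j i = +-monoˡ-≤ 3 (+-mono-≤ (+-mono-≤ (A≤1 i (col (j + 2))) (A≤1 i (col (j + 1)))) (A≤1 i j))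

  d≤ : ∀ i → d i + 3 ≤ 3 * p
  d≤ i = eval-≤ 2 r (λ k _ → s≤ (opposite i) k)

  inverse⇔quotient : 1 ≤ a → IsInverseBL r a ⇔ (∃[ k ] a * BL r + k ≡ p ^ 4 * k + 1)
  inverse⇔quotient 1≤a = subst (λ P → IsInverseBL r a ⇔ (∃[ k ] a * BL r + k ≡ P * k + 1)) 2^4r≡p^4
    (pred∣pred⇔ (*-mono-≤ 1≤a (m≤n+m 1 (2 ^ (2 * r) + p))) (m^n>0 2 (4 * r)))

  Bounded Chains : Matrix → Set
  Bounded c = ∀ i j → i < r → j < 4 → c i j ≤ 2
  Chains c = ∀ j → j < 4 → CarryChain 2 (s j) (λ i → c i j) r′ (c r′ (col (j + 1))) (δ j)

  condB⇔ : ∀ c → CondB r a c ⇔ (Bounded c × Chains c)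
  condB⇔ c = mk⇔ to from
    where
    to : CondB r a c → Bounded c × Chains c
    to (bounded , e₀₀ , e₀ⱼ , eᵢⱼ) = bounded , λ j j<4 → record { base = base j j<4 ; step = step j j<4 }
      where
      base : ∀ j → j < 4 → s j 0 + c r′ (col (j + 1)) ≡ 2 * c 0 j + δ j
      base zero    _   = Equivalence.to (difference⇔ (c 0 0) (c r′ 1) 1 (s 0 0)) e₀₀
      base (suc j) j<4 = trans
        (Equivalence.to (difference⇔′ (c 0 (suc j)) (c r′ (col (suc j + 1))) (s (suc j) 0))
          (e₀ⱼ (suc j) (s≤s z≤n) (≤-pred j<4)))
        (sym (+-identityʳ _))
      step : ∀ j → j < 4 → ∀ i → i < r′ → s j (suc i) + c i j ≡ 2 * c (suc i) j
      step j j<4 i i<r′ = Equivalence.to (difference⇔′ (c (suc i) j) (c i j) (s j (suc i)))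
        (eᵢⱼ (suc i) j (s≤s z≤n) (s≤s i<r′) j<4)
    from : Bounded c × Chains c → CondB r a c
    from (bounded , chains) = bounded
      , Equivalence.from (difference⇔ (c 0 0) (c r′ 1) 1 (s 0 0)) (CarryChain.base (chains 0 z<s))
      , (λ { (suc j) _ j≤3 →
               Equivalence.from (difference⇔′ (c 0 (suc j)) (c r′ (col (suc j + 1))) (s (suc j) 0))
                 (trans (CarryChain.base (chains (suc j) (s≤s j≤3))) (+-identityʳ _)) })
      , (λ { (suc i) j _ i<r j<4 →
               Equivalence.from (difference⇔′ (c (suc i) j) (c i j) (s j (suc i)))
                 (CarryChain.step (chains j j<4) i (≤-pred i<r)) })

  column-sum : ∀ {c} → Chains c → ∀ j → j < 4 → T j + c r′ (col (j + 1)) ≡ p * c r′ j + δ j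
  column-sum chains j j<4 = eval-carries 2 r′ (chains j j<4)

  block-chain : ∀ {c} → Chains c → CarryChain p d (λ k → c r′ (opposite k)) 3 (c r′ 1) 1
  block-chain {c} chains = record { base = column-sum chains 0 z<s ; step = step }
    where
    step : ∀ k → k < 3 → d (suc k) + c r′ (opposite k) ≡ p * c r′ (opposite (suc k))
    step 0 _ = trans (column-sum chains 3 ≤-refl) (+-identityʳ _)
    step 1 _ = trans (column-sum chains 2 (s≤s (s≤s (s≤s z≤n)))) (+-identityʳ _)
    step 2 _ = trans (column-sum chains 1 (s≤s (s≤s z≤n))) (+-identityʳ _)
    step (suc (suc (suc _))) (s≤s (s≤s (s≤s ())))

  chains⇒inverse : ∀ {c} → 1 ≤ a → a < 2 ^ (4 * r) → Chains c → IsInverseBL r a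
  chains⇒inverse {c} 1≤a a<2ⁿ chains = Equivalence.from (inverse⇔quotient 1≤a) (Q + K , quotient)
    where
    open ≡-Reasoning
    K = c r′ 1
    regroup : ∀ P q k → P * q + (P * k + 1) ≡ P * (q + k) + 1
    regroup = solve-∀
    quotient : a * BL r + (Q + K) ≡ p ^ 4 * (Q + K) + 1
    quotient = begin
      a * BL r + (Q + K)           ≡⟨ +-assoc (a * BL r) Q K ⟨
      a * BL r + Q + K             ≡⟨ cong (_+ K) (a*BL-rotation a<2ⁿ) ⟩
      p ^ 4 * Q + eval p d 4 + K   ≡⟨ +-assoc (p ^ 4 * Q) (eval p d 4) K ⟩
      p ^ 4 * Q + (eval p d 4 + K) ≡⟨ cong (λ x → p ^ 4 * Q + x) (eval-carries p 3 (block-chain chains)) ⟩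
      p ^ 4 * Q + (p ^ 4 * K + 1)  ≡⟨ regroup (p ^ 4) Q K ⟩
      p ^ 4 * (Q + K) + 1          ∎

  block-carry : ∀ {k} → a < 2 ^ (4 * r) → a * BL r + k ≡ p ^ 4 * k + 1 →
    ∃[ n ] n ≤ 2 × eval p d 4 + n ≡ p ^ 4 * n + 1
  block-carry {k} a<2ⁿ aBL+k = n , n≤2 , Equivalence.from (affine⇔pos t n P n 1)
    (subst (λ x → + t ℤ.+ x ≡ + P ℤ.* x ℤ.+ + 1) q≡n
      (via-differences (compare′ (+ (a * BL r)) (+ k) (+ Q) (+ P) (+ t)) h₁ h₂))
    where
    P = p ^ 4
    t = eval p d 4
    q = + k ℤ.- + Q
    h₁ : + (a * BL r) ℤ.+ + k ≡ + P ℤ.* + k ℤ.+ + 1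
    h₁ = Equivalence.to (affine⇔pos (a * BL r) k P k 1) aBL+k
    h₂ : + (a * BL r) ℤ.+ + Q ≡ + P ℤ.* + Q ℤ.+ + t
    h₂ = Equivalence.to (affine⇔pos (a * BL r) Q P Q t) (a*BL-rotation a<2ⁿ)
    compare : ∀ x k q P t → (P ℤ.- + 1) ℤ.* (k ℤ.- q) ℤ.+ + 1 ℤ.- t
      ≡ (x ℤ.+ q ℤ.- (P ℤ.* q ℤ.+ t)) ℤ.- (x ℤ.+ k ℤ.- (P ℤ.* k ℤ.+ + 1))
    compare = ℤ-Ring.solve-∀
    compare′ : ∀ x k q P t → t ℤ.+ (k ℤ.- q) ℤ.- (P ℤ.* (k ℤ.- q) ℤ.+ + 1)
      ≡ (x ℤ.+ k ℤ.- (P ℤ.* k ℤ.+ + 1)) ℤ.- (x ℤ.+ q ℤ.- (P ℤ.* q ℤ.+ t))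
    compare′ = ℤ-Ring.solve-∀
    excess : + (P ∸ 1) ℤ.* q ℤ.+ + 1 ≡ + t
    excess = trans (cong (λ x → x ℤ.* q ℤ.+ + 1) (pos-∸ (subst (1 ≤_) 2^4r≡p^4 (m^n>0 2 (4 * r)))))
                   (via-differences (compare (+ (a * BL r)) (+ k) (+ Q) (+ P) (+ t)) h₂ h₁)
    2≤P∸1 : 2 ≤ P ∸ 1
    2≤P∸1 = ≤-trans (s≤s (s≤s z≤n)) (∸-monoˡ-≤ 1 (^-monoˡ-≤ 4 2≤p))
    t≤3[P∸1] : t ≤ 3 * (P ∸ 1)
    t≤3[P∸1] = ≤-trans (m+n≤o⇒m≤o∸n t (eval-≤ p 4 (λ i _ → d≤ i))) (≤-reflexive (sym (*-distribˡ-∸ 3 P 1)))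
    q-carry : IsCarry q
    q-carry = carry-bound q 2≤P∸1 excess t≤3[P∸1]
    n = proj₁ q-carry
    q≡n = proj₁ (proj₂ q-carry)
    n≤2 = proj₂ (proj₂ q-carry)

  module _ {k} (k≤2 : k ≤ 2) (total : eval p d 4 + k ≡ p ^ 4 * k + 1) where

    private
      module Top = CarriesFromTop p d 3 k

      top-carries = Top.carries-chain 2≤p (λ i _ → d≤ i) k≤2 k≤2 (δ≤1 0) total
      top-chain = proj₁ top-carries

    K : ℕ → ℕ
    K j = Top.carry (opposite j)

    K≤2 : ∀ j → j < 4 → K j ≤ 2
    K≤2 j j<4 = proj₂ top-carries (opposite j) (≤-pred (m%n<n (4 ∸ j) 4))

    K-sum : ∀ j → j < 4 → T j + K (col (j + 1)) ≡ p * K j + δ j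
    K-sum 0 _ = trans (cong (λ x → T 0 + x) Top.carry-top) (CarryChain.base top-chain)
    K-sum 1 _ = trans (CarryChain.step top-chain 2 ≤-refl) (sym (+-identityʳ _))
    K-sum 2 _ = trans (CarryChain.step top-chain 1 (s≤s (s≤s z≤n))) (sym (+-identityʳ _))
    K-sum 3 _ = trans (CarryChain.step top-chain 0 z<s) (sym (+-identityʳ _))
    K-sum (suc (suc (suc (suc _)))) (s≤s (s≤s (s≤s (s≤s ()))))

    carries : Matrix
    carries i j = CarriesFromTop.carry 2 (s j) r′ (K j) i

    column : ∀ j → j < 4 →
      CarryChain 2 (s j) (λ i → carries i j) r′ (K (col (j + 1))) (δ j) × (∀ i → i ≤ r′ → carries i j ≤ 2)
    column j j<4 = CarriesFromTop.carries-chain 2 (s j) r′ (K j) ≤-refl (λ i _ → s≤ j i)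
      (K≤2 j j<4) (K≤2 (col (j + 1)) (m%n<n (j + 1) 4)) (δ≤1 j) (K-sum j j<4)

    carries-chains : Chains carries
    carries-chains j j<4 = subst (λ y → CarryChain 2 (s j) (λ i → carries i j) r′ y (δ j))
      (sym (CarriesFromTop.carry-top 2 (s (col (j + 1))) r′ (K (col (j + 1)))))
      (proj₁ (column j j<4))

    carries-bounded : Bounded carries
    carries-bounded i j i<r j<4 = proj₂ (column j j<4) i (≤-pred i<r)

  inverse⇒chains : 1 ≤ a → a < 2 ^ (4 * r) → IsInverseBL r a → ∃[ c ] Bounded c × Chains c
  inverse⇒chains 1≤a a<2ⁿ inv =
    let (k , aBL+k) = Equivalence.to (inverse⇔quotient 1≤a) inv
        (n , n≤2 , total) = block-carry a<2ⁿ aBL+k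
    in carries n≤2 total , carries-bounded n≤2 total , carries-chains n≤2 total

  module _ {c c′} (chains : Chains c) (chains′ : Chains c′) where

    private
      D : ℕ → ℕ → ℤ
      D i j = + c i j ℤ.- + c′ i j

      wraps : ∀ j → j < 4 → D r′ (col (j + 1)) ≡ + 2 ℤ.* D 0 j
      wraps j j<4 = carry-difference 2 {z = s j 0} {x = c 0 j} {x′ = c′ 0 j} {e = δ j}
        (CarryChain.base (chains j j<4)) (CarryChain.base (chains′ j j<4))

      halve : ∀ i j → i < r → j < 4 → ∃[ i₁ ] ∃[ j₁ ] i₁ < r × j₁ < 4 × D i j ≡ + 2 ℤ.* D i₁ j₁
      halve i j i<r j<4 with m<1+n⇒m<n∨m≡n i<r
      ... | inj₁ i<r′ = suc i , j , s≤s i<r′ , j<4 ,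
        carry-difference 2 {z = s j (suc i)} {x = c (suc i) j} {x′ = c′ (suc i) j} {e = 0}
        (trans (CarryChain.step (chains j j<4) i i<r′) (sym (+-identityʳ _)))
        (trans (CarryChain.step (chains′ j j<4) i i<r′) (sym (+-identityʳ _)))
      ... | inj₂ refl with j | j<4
      ...   | 0 | _ = 0 , 3 , z<s , ≤-refl , wraps 3 ≤-refl
      ...   | 1 | _ = 0 , 0 , z<s , z<s , wraps 0 z<s
      ...   | 2 | _ = 0 , 1 , z<s , s≤s (s≤s z≤n) , wraps 1 (s≤s (s≤s z≤n))
      ...   | 3 | _ = 0 , 2 , z<s , s≤s (s≤s (s≤s z≤n)) , wraps 2 (s≤s (s≤s (s≤s z≤n)))
      ...   | suc (suc (suc (suc _))) | s≤s (s≤s (s≤s (s≤s ())))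

    chains-unique : Bounded c → Bounded c′ → ∀ i j → i < r → j < 4 → c i j ≡ c′ i j
    chains-unique bounded bounded′ i j i<r j<4 =
      let (i₁ , j₁ , i₁<r , j₁<4 , D≡2D₁) = halve i j i<r j<4
          (i₂ , j₂ , _ , _ , D₁≡2D₂) = halve i₁ j₁ i₁<r j₁<4
      in m-n≡4z⇒m≡n (D i₂ j₂) (bounded i j i<r j<4) (bounded′ i j i<r j<4)
           (trans D≡2D₁ (trans (cong (+ 2 ℤ.*_) D₁≡2D₂) (sym (ℤₚ.*-assoc (+ 2) (+ 2) (D i₂ j₂)))))

theorem9 : (r : ℕ) .{{_ : NonZero r}} → r % 2 ≡ 1 →
    (a : ℕ) → 1 ≤ a → a ≤ 2 ^ nOf r ∸ 2 →
    (IsInverseBL r a ⇔ ∃ (λ c → CondB r a c))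
    × (∀ c c′ → CondB r a c → CondB r a c′ →
         ∀ i j → i < r → j < 4 → c i j ≡ c′ i j)
theorem9 zero ()
theorem9 (suc r′) _ a 1≤a a≤2ⁿ∸2 = mk⇔ necessary sufficient , unique
  where
  open BLInverse r′ a
  a<2ⁿ : a < 2 ^ (4 * r)
  a<2ⁿ = ≤-<-trans a≤2ⁿ∸2 (∸-monoʳ-< z<s (^-monoʳ-≤ 2 {1} {4 * r} (s≤s z≤n)))
  necessary : IsInverseBL r a → ∃ (λ c → CondB r a c)
  necessary inv = let (c , bc) = inverse⇒chains 1≤a a<2ⁿ inv in c , Equivalence.from (condB⇔ c) bc
  sufficient : ∃ (λ c → CondB r a c) → IsInverseBL r a
  sufficient (c , cond) = chains⇒inverse 1≤a a<2ⁿ (proj₂ (Equivalence.to (condB⇔ c) cond))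
  unique : ∀ c c′ → CondB r a c → CondB r a c′ → ∀ i j → i < r → j < 4 → c i j ≡ c′ i j
  unique c c′ cond cond′ =
    let (bounded , chains) = Equivalence.to (condB⇔ c) cond
        (bounded′ , chains′) = Equivalence.to (condB⇔ c′) cond′
    in chains-unique chains chains′ bounded bounded′
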